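{- Let $n\ge1,m\ge0$. Form a random sequence $v_1,\dots,v_{n+2m}$ where $v_i=i$ for $i\le n$ and, for $k>n$, $v_k$ is a uniformly random element of the multiset $\{v_1,\dots,v_{k-1}\}$ (i.e. $v_k=v_j$ for $j$ uniform in $\{1,\dots,k-1\}$). Let ${\rm PAG}(n,m)$ be the multigraph (loops and multiple edges allowed) on $\{1,\dots,n\}$ whose edges are $e_k=\{v_{n+2k-1},v_{n+2k}\}$, $k=1,\dots,m$. Then for every multigraph $G$ on $\{1,\dots,n\}$ with $m$ edges, conditional on ${\rm PAG}(n,m)=G$, all sequences $((a_1,b_1),\dots,(a_m,b_m))$ of ordered pairs of nodes whose associated multigraph (with edges $\{a_k,b_k\}$) equals $G$ have the same probability of being the realized sequence $((v_{n+1},v_{n+2}),\dots,(v_{n+2m-1},v_{n+2m}))$; that is, all $2^{m'}m!$ ways (orderings of the edges and orientations of the $m'$ non-loop edges) in which the edges of $G$ could have been inserted are equally likely. -}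

module Defs where

open import Data.Nat using (ℕ; zero; suc; _+_; _≟_; NonZero)
open import Data.Fin using (Fin) renaming (_≟_ to _≟ᶠ_)
open import Data.Fin.Properties using (all?)
open import Data.List using (List; []; _∷_; _++_; [_]; length; lookup; allFin; concatMap; filter; drop)
open import Data.List.Properties using () renaming (≡-dec to ≡-decᴸ)
open import Data.Product using (_×_; _,_)
open import Data.Product.Properties using () renaming (≡-dec to ≡-decˣ)
open import Data.Sum using (_⊎_)
open import Data.Integer using (+_)
open import Data.Rational using (ℚ; _/_)
open import Relation.Binary.PropositionalEquality using (_≡_)
open import Relation.Nullary using (Dec; yes; no)
open import Relation.Nullary.Decidable using (_⊎-dec_; _×-dec_)
open import Relation.Unary using (Pred; Decidable)

-- Nodes 1..n are represented by Fin n (node i ↦ i-1).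

-- Starting from the current
-- sequence vs = (v_1,...,v_{k-1}), one step picks j uniformly in
-- {1,...,k-1} (here: an index in Fin (length vs)) and appends v_j.
-- `outcomes s vs` lists, for every choice sequence (j_k)_k of the next
-- s steps, the resulting full sequence.  Each entry corresponds to exactly
-- one choice sequence, and all choice sequences are equally likely
-- (independent uniform choices), so probabilities are counts in this list
-- divided by its length.
outcomes : ∀ {n} → ℕ → List (Fin n) → List (List (Fin n))
outcomes zero    vs = [ vs ]
outcomes (suc s) vs = concatMap (λ j → outcomes s (vs ++ [ lookup vs j ])) (allFin (length vs))

Ω : (n m : ℕ) → List (List (Fin n))
Ω n m = outcomes (m + m) (allFin n)

pairsOf : ∀ {A : Set} → List A → List (A × A)
pairsOf (a ∷ b ∷ r) = (a , b) ∷ pairsOf r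
pairsOf _           = []

insertSeq : (n : ℕ) → List (Fin n) → List (Fin n × Fin n)
insertSeq n vs = pairsOf (drop n vs)

-- A multigraph on Fin n (loops and multiple edges allowed), given by its
-- edge multiplicities: G x y = number of edges {x,y}.
Multigraph : ℕ → Set
Multigraph n = Fin n → Fin n → ℕ

isEdge? : ∀ {n} (x y : Fin n) → Decidable (λ (p : Fin n × Fin n) →
          let (a , b) = p in (a ≡ x × b ≡ y) ⊎ (a ≡ y × b ≡ x))
isEdge? x y (a , b) = ((a ≟ᶠ x) ×-dec (b ≟ᶠ y)) ⊎-dec ((a ≟ᶠ y) ×-dec (b ≟ᶠ x))

graphOf : ∀ {n} → List (Fin n × Fin n) → Multigraph n
graphOf ps x y = length (filter (isEdge? x y) ps)

_≈G_ : ∀ {n} → Multigraph n → Multigraph n → Set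
G ≈G H = ∀ x y → G x y ≡ H x y

_≈G?_ : ∀ {n} (G H : Multigraph n) → Dec (G ≈G H)
G ≈G? H = all? (λ x → all? (λ y → G x y ≟ H x y))

PAG : (n : ℕ) → List (Fin n) → Multigraph n
PAG n vs = graphOf (insertSeq n vs)

#PAG : (n m : ℕ) → Multigraph n → ℕ
#PAG n m G = length (filter (λ vs → PAG n vs ≈G? G) (Ω n m))

#Seq∧PAG : (n m : ℕ) → List (Fin n × Fin n) → Multigraph n → ℕ
#Seq∧PAG n m ps G = length (filter (λ vs → ≡-decᴸ (≡-decˣ _≟ᶠ_ _≟ᶠ_) (insertSeq n vs) ps ×-dec (PAG n vs ≈G? G)) (Ω n m))

condProb : (n m : ℕ) (ps : List (Fin n × Fin n)) (G : Multigraph n) → .{{NonZero (#PAG n m G)}} → ℚ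
condProb n m ps G = (+ #Seq∧PAG n m ps G) / #PAG n m G

module Submission where

-- The process is a Pólya urn: the urn initially holds one ball of each node, and each
-- step draws a ball uniformly and returns it together with a copy. The number of choice
-- sequences producing a given sequence of draws w is the product, over the draws, of
-- the multiplicity of the drawn colour in the urn at that moment; colour by colour this
-- is a rising factorial, so the product depends only on the multiset of w. Two sequences
-- of ordered pairs with the same multigraph flatten to permutations of each other, so
-- they are realised by equally many outcomes.

open import Defs
open import Data.Nat using (ℕ; _≥_; NonZero; zero; suc; _+_; _*_; _<_)
open import Data.Nat.Properties using (suc-injective; +-suc; *-comm; *-assoc; <-irrefl)
open import Data.Nat.ListAction using (sum)
open import Data.Fin using (Fin) renaming (_≟_ to _≟ᶠ_)
open import Data.List
  using (List; []; _∷_; _++_; _∷ʳ_; [_]; length; filter; map; concatMap; allFin; tabulate; lookup; drop)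
open import Data.List.Properties
  using (length-++; filter-++; filter-accept; filter-reject; filter-none; filter-some; ++-assoc; ++-identityʳ; ++-cancelˡ; ∷ʳ-++;
         ∷-injectiveˡ; map-tabulate; tabulate-lookup; length-tabulate)
  renaming (≡-dec to ≡-decᴸ)
open import Data.List.Membership.Propositional using (_∈_)
open import Data.List.Membership.Propositional.Properties using (∈-∃++; ∈-filter⁻)
open import Data.List.Relation.Unary.All using (All; []; _∷_)
import Data.List.Relation.Unary.All as All
open import Data.List.Relation.Unary.All.Properties using (concat⁺; map⁺; tabulate⁺)
open import Data.List.Relation.Unary.Any using (here)
open import Data.List.Relation.Binary.Permutation.Propositional using (_↭_; refl; prep; swap; trans; ↭-trans; ↭-sym)
open import Data.List.Relation.Binary.Permutation.Propositional.Properties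
  using (shift; shifts; ∷↭∷ʳ; ++⁺ˡ; ++⁺ʳ; filter-↭; ↭-length)
open import Data.Product using (_×_; _,_; ∃-syntax)
open import Data.Sum using (_⊎_; inj₁; inj₂)
import Data.Sum as Sum
import Data.Product as Product
open import Data.Empty using (⊥-elim)
import Data.Integer as ℤ
open import Data.Rational using (_/_)
open import Function using (_∘_)
open import Function.Bundles using (_⇔_; mk⇔; Equivalence)
open import Relation.Binary.Definitions using (DecidableEquality)
open import Relation.Binary.PropositionalEquality using (_≡_; _≢_; cong; cong₂; sym; subst; subst₂; module ≡-Reasoning)
  renaming (refl to ≡-refl; trans to ≡-trans)
open import Relation.Nullary using (yes; no)
open import Relation.Unary using (Decidable)

module _ {A : Set} where

  length-filter-cong : {P Q : A → Set} (P? : Decidable P) (Q? : Decidable Q) {xs : List A} →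
                       All (λ x → P x ⇔ Q x) xs → length (filter P? xs) ≡ length (filter Q? xs)
  length-filter-cong P? Q? {[]}     []           = ≡-refl
  length-filter-cong P? Q? {x ∷ xs} (P⇔Q ∷ rest) with P? x | Q? x
  ... | yes _  | yes _  = cong suc (length-filter-cong P? Q? rest)
  ... | no  _  | no  _  = length-filter-cong P? Q? rest
  ... | yes px | no ¬qx = ⊥-elim (¬qx (Equivalence.to P⇔Q px))
  ... | no ¬px | yes qx = ⊥-elim (¬px (Equivalence.from P⇔Q qx))

  length-filter-∷-cong : {P : A → Set} (P? : Decidable P) {x y : A} {xs : List A} → P x ⇔ P y →
                         length (filter P? (x ∷ xs)) ≡ length (filter P? (y ∷ xs))
  length-filter-∷-cong P? {x} {y} Px⇔Py with P? x | P? y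
  ... | yes _  | yes _  = ≡-refl
  ... | no  _  | no  _  = ≡-refl
  ... | yes px | no ¬py = ⊥-elim (¬py (Equivalence.to Px⇔Py px))
  ... | no ¬px | yes py = ⊥-elim (¬px (Equivalence.from Px⇔Py py))

  length-filter-∷-cancelˡ : {P : A → Set} (P? : Decidable P) {x : A} {xs ys : List A} →
                            length (filter P? (x ∷ xs)) ≡ length (filter P? (x ∷ ys)) →
                            length (filter P? xs) ≡ length (filter P? ys)
  length-filter-∷-cancelˡ P? {x} eq with P? x
  ... | yes _ = suc-injective eq
  ... | no  _ = eq

  filter-nonempty⇒∈ : {P : A → Set} (P? : Decidable P) (xs : List A) →
                      0 < length (filter P? xs) → ∃[ x ] x ∈ xs × P x
  filter-nonempty⇒∈ P? xs _ with filter P? xs | (λ {v} → ∈-filter⁻ P? {v} {xs})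
  ... | y ∷ _ | from∈ = y , from∈ (here ≡-refl)

  ∈⇒↭∷ : {x : A} {xs : List A} → x ∈ xs → ∃[ ys ] xs ↭ x ∷ ys
  ∈⇒↭∷ x∈xs with ∈-∃++ x∈xs
  ... | pre , post , ≡-refl = pre ++ post , shift _ pre post

  drop-length-++ : (xs ys : List A) → drop (length xs) (xs ++ ys) ≡ ys
  drop-length-++ []       ys = ≡-refl
  drop-length-++ (x ∷ xs) ys = drop-length-++ xs ys

  map-lookup-allFin : {B : Set} (f : A → B) (xs : List A) → map (f ∘ lookup xs) (allFin (length xs)) ≡ map f xs
  map-lookup-allFin f xs = begin
    map (f ∘ lookup xs) (tabulate (λ i → i)) ≡⟨ map-tabulate (λ i → i) (f ∘ lookup xs) ⟩
    tabulate (f ∘ lookup xs)                 ≡⟨ map-tabulate (lookup xs) f ⟨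
    map f (tabulate (lookup xs))             ≡⟨ cong (map f) (tabulate-lookup xs) ⟩
    map f xs                                 ∎
    where open ≡-Reasoning

module Counting {A : Set} (_≟_ : DecidableEquality A) where

  count : A → List A → ℕ
  count x xs = length (filter (_≟ x) xs)

  count-↭ : ∀ x {xs ys} → xs ↭ ys → count x xs ≡ count x ys
  count-↭ x xs↭ys = ↭-length (filter-↭ (_≟ x) xs↭ys)

  count-[x] : ∀ x → count x [ x ] ≡ 1
  count-[x] x = cong length (filter-accept (_≟ x) ≡-refl)

  count-absent : ∀ x {xs} → All (_≢ x) xs → count x xs ≡ 0
  count-absent x none = cong length (filter-none (_≟ x) none)

  count-concatMap : ∀ x {B : Set} (f : B → List A) (bs : List B) →
                    count x (concatMap f bs) ≡ sum (map (count x ∘ f) bs)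
  count-concatMap x f []       = ≡-refl
  count-concatMap x f (b ∷ bs) = ≡-trans (cong length (filter-++ (_≟ x) (f b) (concatMap f bs)))
    (≡-trans (length-++ (filter (_≟ x) (f b))) (cong (count x (f b) +_) (count-concatMap x f bs)))

  sum-map-supported : ∀ x (g : A → ℕ) → (∀ {y} → y ≢ x → g y ≡ 0) →
                      ∀ xs → sum (map g xs) ≡ count x xs * g x
  sum-map-supported x g off []       = ≡-refl
  sum-map-supported x g off (y ∷ xs) with y ≟ x
  ... | yes ≡-refl = cong (g y +_) (sum-map-supported x g off xs)
  ... | no  y≢x    = cong₂ _+_ (off y≢x) (sum-map-supported x g off xs)

  count-∷ʳ-comm : ∀ x y us → count x us * count y (us ∷ʳ x) ≡ count y us * count x (us ∷ʳ y)
  count-∷ʳ-comm x y us with x ≟ y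
  ... | yes ≡-refl = ≡-refl
  ... | no  x≢y    = begin
    count x us * count y (us ∷ʳ x) ≡⟨ cong (count x us *_) (count-↭ y (↭-sym (∷↭∷ʳ x us))) ⟩
    count x us * count y (x ∷ us)  ≡⟨ cong (λ c → count x us * length c) (filter-reject (_≟ y) x≢y) ⟩
    count x us * count y us        ≡⟨ *-comm (count x us) (count y us) ⟩
    count y us * count x us        ≡⟨ cong (λ c → count y us * length c) (filter-reject (_≟ x) (x≢y ∘ sym)) ⟨
    count y us * count x (y ∷ us)  ≡⟨ cong (count y us *_) (count-↭ x (↭-sym (∷↭∷ʳ y us))) ⟨
    count y us * count x (us ∷ʳ y) ∎
    where open ≡-Reasoning

-- urnWeight us w counts the ways of drawing w in order from the Pólya urn us.
module Urn {A : Set} (_≟_ : DecidableEquality A) where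
  open Counting _≟_

  urnWeight : List A → List A → ℕ
  urnWeight us []      = 1
  urnWeight us (x ∷ w) = count x us * urnWeight (us ∷ʳ x) w

  urnWeight-resp-↭ : ∀ {us us'} → us ↭ us' → ∀ w → urnWeight us w ≡ urnWeight us' w
  urnWeight-resp-↭ us↭us' []      = ≡-refl
  urnWeight-resp-↭ us↭us' (x ∷ w) =
    cong₂ _*_ (count-↭ x us↭us') (urnWeight-resp-↭ (++⁺ʳ [ x ] us↭us') w)

  urnWeight-swap : ∀ us x y w → urnWeight us (x ∷ y ∷ w) ≡ urnWeight us (y ∷ x ∷ w)
  urnWeight-swap us x y w = begin
    count x us * (count y (us ∷ʳ x) * urnWeight (us ∷ʳ x ∷ʳ y) w) ≡⟨ *-assoc (count x us) _ _ ⟨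
    count x us * count y (us ∷ʳ x) * urnWeight (us ∷ʳ x ∷ʳ y) w   ≡⟨ cong₂ _*_ (count-∷ʳ-comm x y us) (urnWeight-resp-↭ urn↭ w) ⟩
    count y us * count x (us ∷ʳ y) * urnWeight (us ∷ʳ y ∷ʳ x) w   ≡⟨ *-assoc (count y us) _ _ ⟩
    count y us * (count x (us ∷ʳ y) * urnWeight (us ∷ʳ y ∷ʳ x) w) ∎
    where
    open ≡-Reasoning
    urn↭ : us ∷ʳ x ∷ʳ y ↭ us ∷ʳ y ∷ʳ x
    urn↭ = subst₂ _↭_ (sym (++-assoc us [ x ] [ y ])) (sym (++-assoc us [ y ] [ x ]))
                      (++⁺ˡ us (swap x y refl))

  urnWeight-↭ : ∀ {w w'} → w ↭ w' → ∀ us → urnWeight us w ≡ urnWeight us w'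
  urnWeight-↭ refl                 us = ≡-refl
  urnWeight-↭ (prep x w↭w')        us = cong (count x us *_) (urnWeight-↭ w↭w' (us ∷ʳ x))
  urnWeight-↭ (swap {w} x y w↭w')  us =
    ≡-trans (urnWeight-swap us x y w)
            (cong (λ k → count y us * (count x (us ∷ʳ y) * k)) (urnWeight-↭ w↭w' (us ∷ʳ y ∷ʳ x)))
  urnWeight-↭ (trans w↭w'' w''↭w') us = ≡-trans (urnWeight-↭ w↭w'' us) (urnWeight-↭ w''↭w' us)

module _ {A : Set} where

  flatten : List (A × A) → List A
  flatten []             = []
  flatten ((a , b) ∷ ps) = a ∷ b ∷ flatten ps

  length-flatten : (ps : List (A × A)) → length (flatten ps) ≡ length ps + length ps
  length-flatten []       = ≡-refl
  length-flatten (p ∷ ps) = cong suc (≡-trans (cong suc (length-flatten ps)) (sym (+-suc (length ps) (length ps))))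

  pairsOf-flatten : (ps : List (A × A)) → pairsOf (flatten ps) ≡ ps
  pairsOf-flatten []             = ≡-refl
  pairsOf-flatten ((a , b) ∷ ps) = cong ((a , b) ∷_) (pairsOf-flatten ps)

  pairsOf≡⇒≡flatten : (w : List A) (ps : List (A × A)) → length w ≡ length (flatten ps) →
                      pairsOf w ≡ ps → w ≡ flatten ps
  pairsOf≡⇒≡flatten []          []       _   _      = ≡-refl
  pairsOf≡⇒≡flatten (a ∷ b ∷ w) (_ ∷ ps) len ≡-refl =
    cong (λ t → a ∷ b ∷ t) (pairsOf≡⇒≡flatten w ps (suc-injective (suc-injective len)) ≡-refl)

  flatten⁺ : {ps qs : List (A × A)} → ps ↭ qs → flatten ps ↭ flatten qs
  flatten⁺ refl                            = refl
  flatten⁺ (prep (a , b) ps↭qs)            = prep a (prep b (flatten⁺ ps↭qs))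
  flatten⁺ (swap {ps} (a , b) (c , d) ps↭qs) =
    ↭-trans (shifts (a ∷ b ∷ []) (c ∷ d ∷ []) {flatten ps}) (prep c (prep d (prep a (prep b (flatten⁺ ps↭qs)))))
  flatten⁺ (trans ps↭rs rs↭qs)             = ↭-trans (flatten⁺ ps↭rs) (flatten⁺ rs↭qs)

module _ {n : ℕ} where
  open Counting (_≟ᶠ_ {n})
  open Urn (_≟ᶠ_ {n})
  module Outcomes = Counting (≡-decᴸ (_≟ᶠ_ {n}))

  outcomes-extend : ∀ s (vs : List (Fin n)) → All (λ r → ∃[ w ] length w ≡ s × r ≡ vs ++ w) (outcomes s vs)
  outcomes-extend zero    vs = ([] , ≡-refl , sym (++-identityʳ vs)) ∷ []
  outcomes-extend (suc s) vs = concat⁺ (map⁺ (tabulate⁺ λ j →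
    All.map (λ { (w , len , ≡-refl) → lookup vs j ∷ w , cong suc len , ∷ʳ-++ vs (lookup vs j) w })
            (outcomes-extend s (vs ∷ʳ lookup vs j))))

  count-outcomes : ∀ (vs w : List (Fin n)) → Outcomes.count (vs ++ w) (outcomes (length w) vs) ≡ urnWeight vs w
  count-outcomes vs []      = ≡-trans (cong (λ t → Outcomes.count t [ vs ]) (++-identityʳ vs)) (Outcomes.count-[x] vs)
  count-outcomes vs (x ∷ w) = begin
    Outcomes.count target (concatMap (branch ∘ lookup vs) (allFin (length vs)))
      ≡⟨ Outcomes.count-concatMap target (branch ∘ lookup vs) (allFin (length vs)) ⟩
    sum (map (matches ∘ lookup vs) (allFin (length vs)))
      ≡⟨ cong sum (map-lookup-allFin matches vs) ⟩
    sum (map matches vs)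
      ≡⟨ sum-map-supported x matches mismatch vs ⟩
    count x vs * matches x
      ≡⟨ cong (λ t → count x vs * Outcomes.count t (branch x)) (∷ʳ-++ vs x w) ⟨
    count x vs * Outcomes.count ((vs ∷ʳ x) ++ w) (branch x)
      ≡⟨ cong (count x vs *_) (count-outcomes (vs ∷ʳ x) w) ⟩
    urnWeight vs (x ∷ w) ∎
    where
    open ≡-Reasoning
    target = vs ++ x ∷ w
    branch : Fin n → List (List (Fin n))
    branch y = outcomes (length w) (vs ∷ʳ y)
    matches : Fin n → ℕ
    matches y = Outcomes.count target (branch y)
    mismatch : ∀ {y} → y ≢ x → matches y ≡ 0
    mismatch {y} y≢x = Outcomes.count-absent target (All.map
      (λ { (w' , _ , ≡-refl) eq → y≢x (∷-injectiveˡ (++-cancelˡ vs _ _ (≡-trans (sym (∷ʳ-++ vs y w')) eq))) })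
      (outcomes-extend (length w) (vs ∷ʳ y)))

  ≈G-sym : {G H : Multigraph n} → G ≈G H → H ≈G G
  ≈G-sym G≈H x y = sym (G≈H x y)

  ≈G-trans : {G H K : Multigraph n} → G ≈G H → H ≈G K → G ≈G K
  ≈G-trans G≈H H≈K x y = ≡-trans (G≈H x y) (H≈K x y)

  graphOf-↭ : ∀ {ps qs : List (Fin n × Fin n)} → ps ↭ qs → graphOf ps ≈G graphOf qs
  graphOf-↭ ps↭qs x y = ↭-length (filter-↭ (isEdge? x y) ps↭qs)

  graphOf-flip : ∀ (a b : Fin n) ps → graphOf ((b , a) ∷ ps) ≈G graphOf ((a , b) ∷ ps)
  graphOf-flip a b ps x y = length-filter-∷-cong (isEdge? x y) {b , a} {a , b} {ps} (mk⇔ flip flip)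
    where
    flip : ∀ {u v} → (u ≡ x × v ≡ y) ⊎ (u ≡ y × v ≡ x) → (v ≡ x × u ≡ y) ⊎ (v ≡ y × u ≡ x)
    flip = Sum.swap ∘ Sum.map Product.swap Product.swap

  graphOf-∷-cancelˡ : ∀ (p : Fin n × Fin n) {ps qs} → graphOf (p ∷ ps) ≈G graphOf (p ∷ qs) → graphOf ps ≈G graphOf qs
  graphOf-∷-cancelˡ p {ps} {qs} eq x y = length-filter-∷-cancelˡ (isEdge? x y) {p} {ps} {qs} (eq x y)

  graphOf-∷-pos : ∀ (a b : Fin n) ps → 0 < graphOf ((a , b) ∷ ps) a b
  graphOf-∷-pos a b ps = filter-some (isEdge? a b) (here (inj₁ (≡-refl , ≡-refl)))

  edge-split : ∀ (a b : Fin n) qs → 0 < graphOf qs a b → ∃[ rest ] (qs ↭ (a , b) ∷ rest ⊎ qs ↭ (b , a) ∷ rest)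
  edge-split a b qs pos with filter-nonempty⇒∈ (isEdge? a b) qs pos
  ... | (a , b) , q∈qs , inj₁ (≡-refl , ≡-refl) = Product.map₂ inj₁ (∈⇒↭∷ q∈qs)
  ... | (b , a) , q∈qs , inj₂ (≡-refl , ≡-refl) = Product.map₂ inj₂ (∈⇒↭∷ q∈qs)

  ≈G⇒flatten-↭ : ∀ (ps qs : List (Fin n × Fin n)) → graphOf ps ≈G graphOf qs → flatten ps ↭ flatten qs
  ≈G⇒flatten-↭ []             []             _  = refl
  ≈G⇒flatten-↭ []             ((a , b) ∷ qs) eq = ⊥-elim (<-irrefl ≡-refl (subst (0 <_) (sym (eq a b)) (graphOf-∷-pos a b qs)))
  ≈G⇒flatten-↭ ((a , b) ∷ ps) qs             eq with edge-split a b qs (subst (0 <_) (eq a b) (graphOf-∷-pos a b ps))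
  ... | rest , inj₁ qs↭ = ↭-trans (prep a (prep b (≈G⇒flatten-↭ ps rest
                            (graphOf-∷-cancelˡ (a , b) (≈G-trans eq (graphOf-↭ qs↭))))))
                            (↭-sym (flatten⁺ qs↭))
  ... | rest , inj₂ qs↭ = ↭-trans (swap a b (≈G⇒flatten-↭ ps rest
                            (graphOf-∷-cancelˡ (a , b) (≈G-trans eq (≈G-trans (graphOf-↭ qs↭) (graphOf-flip a b rest))))))
                            (↭-sym (flatten⁺ qs↭))

  insertSeq-allFin-++ : ∀ w → insertSeq n (allFin n ++ w) ≡ pairsOf w
  insertSeq-allFin-++ w = cong pairsOf
    (subst (λ k → drop k (allFin n ++ w) ≡ w) (length-tabulate {n = n} (λ i → i)) (drop-length-++ (allFin n) w))

  realizes⇔≡ : ∀ {G} {ps} (w : List (Fin n)) → length w ≡ length (flatten ps) → graphOf ps ≈G G →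
               (insertSeq n (allFin n ++ w) ≡ ps × PAG n (allFin n ++ w) ≈G G) ⇔ (allFin n ++ w ≡ allFin n ++ flatten ps)
  realizes⇔≡ {G} {ps} w len ps≈G = mk⇔
    (λ (realizes , _) → cong (allFin n ++_)
       (pairsOf≡⇒≡flatten w ps len (≡-trans (sym (insertSeq-allFin-++ w)) realizes)))
    (λ eq → let realizes = ≡-trans (insertSeq-allFin-++ w)
                             (≡-trans (cong pairsOf (++-cancelˡ (allFin n) _ _ eq)) (pairsOf-flatten ps))
            in realizes , subst (λ t → graphOf t ≈G G) (sym realizes) ps≈G)

  #Seq∧PAG≡urnWeight : ∀ {m G ps} → length ps ≡ m → graphOf ps ≈G G → #Seq∧PAG n m ps G ≡ urnWeight (allFin n) (flatten ps)
  #Seq∧PAG≡urnWeight {m} {G} {ps} ≡-refl ps≈G = begin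
    #Seq∧PAG n m ps G
      ≡⟨ length-filter-cong _ _ (All.map (λ { (w , len , ≡-refl) → realizes⇔≡ w (≡-trans len m+m≡) ps≈G })
                                         (outcomes-extend (m + m) (allFin n))) ⟩
    Outcomes.count target (outcomes (m + m) (allFin n))
      ≡⟨ cong (λ s → Outcomes.count target (outcomes s (allFin n))) m+m≡ ⟩
    Outcomes.count target (outcomes (length (flatten ps)) (allFin n))
      ≡⟨ count-outcomes (allFin n) (flatten ps) ⟩
    urnWeight (allFin n) (flatten ps) ∎
    where
    open ≡-Reasoning
    target = allFin n ++ flatten ps
    m+m≡ : m + m ≡ length (flatten ps)
    m+m≡ = sym (length-flatten ps)

lemma3p4 : (n m : ℕ) → n ≥ 1 → (G : Multigraph n) →
           (ps qs : List (Fin n × Fin n)) →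
           length ps ≡ m → length qs ≡ m →
           graphOf ps ≈G G → graphOf qs ≈G G →
           .{{_ : NonZero (#PAG n m G)}} →
           condProb n m ps G ≡ condProb n m qs G
lemma3p4 n m _ G ps qs lp lq ps≈G qs≈G = cong (λ k → ℤ.+ k / #PAG n m G) (begin
  #Seq∧PAG n m ps G                  ≡⟨ #Seq∧PAG≡urnWeight lp ps≈G ⟩
  urnWeight (allFin n) (flatten ps)  ≡⟨ urnWeight-↭ (≈G⇒flatten-↭ ps qs (≈G-trans ps≈G (≈G-sym qs≈G))) (allFin n) ⟩
  urnWeight (allFin n) (flatten qs)  ≡⟨ #Seq∧PAG≡urnWeight lq qs≈G ⟨
  #Seq∧PAG n m qs G                  ∎)
  where
  open ≡-Reasoning
  open Urn (_≟ᶠ_ {n})
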